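{- A permutation $r$ has steady-state time $0$ if and only if $r$ is the row reading word of a standard tableau.
   Context: Box-ball system (BBS): boxes are arranged in a row extending infinitely to the right, each box holds at most one ball, balls are labeled $1,\dots,n$. A permutation $r=r_1\cdots r_n$ gives the time-$0$ configuration with ball $r_i$ in the $i$-th of $n$ consecutive boxes. A BBS move moves ball $1$ to the nearest empty box to its right, then ball $2$, ..., then ball $n$; the state at time $t$ is obtained after $t$ moves. An increasing run is a maximal block of balls in consecutive boxes with labels increasing left to right; a soliton is an increasing run preserved by all subsequent BBS moves (its balls stay consecutive and in order, and the runs keep their relative order). A configuration is in steady state if all its increasing runs are solitons (the lengths of which then weakly decrease from right to left). The steady-state time of $r$ is the least $t\ge0$ such that the state at time $t$ is in steady state. The row reading word of a tableau (English notation) is the concatenation of its rows from bottom to top, each read left to right. -}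

module Defs where

open import Data.Nat using (ℕ; zero; suc; _<_; _≤_; _<?_; _≟_)
open import Data.List using (List; []; _∷_; _++_; map; foldl; upTo; reverse; length; zip; concat)
open import Data.List.Relation.Unary.All using (All)
open import Data.List.Relation.Binary.Permutation.Propositional using (_↭_)
open import Data.Maybe using (Maybe; just; nothing)
open import Data.Product using (_×_; Σ; ∃; uncurry)
open import Relation.Binary.PropositionalEquality using (_≡_)
open import Relation.Nullary using (yes; no)

-- Configurations: boxes 0,1,2,... ; position i holds `just b` (ball b)
-- or `nothing` (empty).  All boxes beyond the end of the list are empty.

Config : Set
Config = List (Maybe ℕ)

oneTo : ℕ → List ℕ
oneTo n = map suc (upTo n)

IsPerm : ℕ → List ℕ → Set
IsPerm n r = r ↭ oneTo n

initial : List ℕ → Config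
initial r = map just r

place : ℕ → Config → Config
place k [] = just k ∷ []
place k (nothing ∷ c) = just k ∷ c
place k (just m ∷ c) = just m ∷ place k c

moveBall : ℕ → Config → Config
moveBall k [] = []
moveBall k (nothing ∷ c) = nothing ∷ moveBall k c
moveBall k (just m ∷ c) with m ≟ k
... | yes _ = nothing ∷ place k c
... | no _  = just m ∷ moveBall k c

bbsMove : ℕ → Config → Config
bbsMove n c = foldl (λ d k → moveBall k d) c (oneTo n)

bbsIter : ℕ → ℕ → Config → Config
bbsIter n zero c = c
bbsIter n (suc t) c = bbsMove n (bbsIter n t c)

-- Increasing runs: maximal blocks of balls in consecutive boxes with
-- labels increasing left to right, listed left to right.

private
  flush : List ℕ → List (List ℕ)
  flush [] = []
  flush (x ∷ xs) = reverse (x ∷ xs) ∷ []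

  -- first argument: current (reversed) run
  runsAux : List ℕ → Config → List (List ℕ)
  runsAux cur [] = flush cur
  runsAux cur (nothing ∷ c) = flush cur ++ runsAux [] c
  runsAux [] (just m ∷ c) = runsAux (m ∷ []) c
  runsAux (p ∷ cur) (just m ∷ c) with p <? m
  ... | yes _ = runsAux (m ∷ p ∷ cur) c
  ... | no _  = reverse (p ∷ cur) ∷ runsAux (m ∷ []) c

runs : Config → List (List ℕ)
runs = runsAux []

-- Steady state (n balls): every increasing run is a soliton, i.e. is
-- preserved by all subsequent BBS moves (stays an increasing run, balls
-- consecutive and in order) and the runs keep their relative order.
SteadyState : ℕ → Config → Set
SteadyState n c = ∀ s → runs (bbsIter n s c) ≡ runs c

SteadyStateTimeZero : ℕ → List ℕ → Set
SteadyStateTimeZero n r = SteadyState n (initial r)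

-- Standard Young tableaux, English notation: a list of rows, top to bottom.

data StrictlyIncreasing : List ℕ → Set where
  []  : StrictlyIncreasing []
  [-] : ∀ {x} → StrictlyIncreasing (x ∷ [])
  _∷_ : ∀ {x y xs} → x < y → StrictlyIncreasing (y ∷ xs) → StrictlyIncreasing (x ∷ y ∷ xs)

NonEmpty : List ℕ → Set
NonEmpty xs = 1 ≤ length xs

RowPairOK : List ℕ → List ℕ → Set
RowPairOK upper lower = (length lower ≤ length upper) × All (uncurry _<_) (zip upper lower)

data ConsecutiveRowsOK : List (List ℕ) → Set where
  []  : ConsecutiveRowsOK []
  [-] : ∀ {a} → ConsecutiveRowsOK (a ∷ [])
  _∷_ : ∀ {a b rs} → RowPairOK a b → ConsecutiveRowsOK (b ∷ rs) → ConsecutiveRowsOK (a ∷ b ∷ rs)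

IsStandardTableau : ℕ → List (List ℕ) → Set
IsStandardTableau n T =
  All NonEmpty T × All StrictlyIncreasing T × ConsecutiveRowsOK T × (concat T ↭ oneTo n)

rowReadingWord : List (List ℕ) → List ℕ
rowReadingWord T = concat (reverse T)

-- A BBS move is the passage of a carrier from left to right that performs
-- Schensted row insertion: it row-inserts every ball it meets, leaving the
-- bumped ball (if any) in that box, and at an empty box it drops its smallest
-- ball.
--
-- If r is the row reading word of a standard tableau, the configuration is
-- the rows of the tableau, bottom to top, separated by empty boxes.  A carrier
-- holding one row and meeting the next (longer, columnwise smaller) row bumps
-- out the row it holds ball for ball and ends up holding the new row, so
-- every move reproduces the same rows in the same order, separated by empty
-- boxes; these rows are the increasing runs.
--
-- Conversely, a steady configuration keeps in particular the order of its
-- balls under one move.  After one move of the packed word r the balls read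
-- u v, where v is the first row of the insertion tableau of r and u is the
-- word of bumped balls.  From r = u v it follows that u has the same
-- property and that the first row of the insertion tableau of u fits under v;
-- so r is the reading word of the tableau with top row v above the tableau
-- obtained recursively from u.

module Submission where

open import Defs
open import Data.Nat using (ℕ)
open import Data.List using (List)
open import Data.Product using (Σ; _×_)
open import Function.Bundles using (_⇔_)
open import Relation.Binary.PropositionalEquality using (_≡_)

open import Data.Bool using (Bool; true; false; if_then_else_)
open import Data.Empty using (⊥-elim)
open import Data.List
  using ([]; _∷_; _++_; _ʳ++_; map; foldl; concat; reverse; length; head; drop; replicate; catMaybes)
open import Data.List.Properties
  using ( ++-assoc; ++-identityʳ; map-++; unfold-reverse; reverse-involutive; concat-++; length-++
        ; catMaybes-++; foldl-++; ∷-injectiveˡ; ∷-injectiveʳ)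
open import Data.List.Membership.Propositional using (_∈_; _∉_)
open import Data.List.Relation.Unary.All as All using (All; []; _∷_)
import Data.List.Relation.Unary.All.Properties as All
open import Data.List.Relation.Unary.AllPairs as AllPairs using (AllPairs; []; _∷_)
import Data.List.Relation.Unary.AllPairs.Properties as AllPairs
open import Data.List.Relation.Unary.Any using (here; there)
open import Data.List.Relation.Unary.Unique.Propositional using (Unique)
open import Data.List.Relation.Binary.Permutation.Propositional
  using (_↭_; ↭-sym; ↭-trans; ↭-refl; ↭⇒↭ₛ; module PermutationReasoning)
open import Data.List.Relation.Binary.Permutation.Propositional.Properties using (∈-resp-↭; ++⁺ˡ; ++-comm)
import Data.List.Relation.Binary.Permutation.Setoid.Properties as Permutationₛ
open import Data.Maybe using (Maybe; just; nothing)
open import Data.Maybe.Properties using (just-injective)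
open import Data.Nat using (zero; suc; _+_; _<_; _≤_; _<?_; _≟_; z≤n; s≤s; s<s)
open import Data.Nat.Properties
  using ( <-trans; <-asym; <-irrefl; <⇒≢; <⇒≤; ≤-refl; ≤-trans; ≤-<-trans; ≤∧≢⇒<; ≮⇒≥; ≤-pred; n≤1+n
        ; +-comm; +-monoʳ-≤; module ≤-Reasoning)
open import Data.List.Membership.DecPropositional _≟_ using (_∈?_)
open import Data.Product using (_,_; proj₁; proj₂; ∃)
open import Data.Sum using (_⊎_; inj₁; inj₂; [_,_]′)
open import Function using (_∘_; _∋_; id)
open import Function.Bundles using (mk⇔)
open import Relation.Binary.PropositionalEquality
  using (refl; sym; trans; cong; cong₂; subst; _≢_; setoid; module ≡-Reasoning)
open import Relation.Nullary using (¬_; yes; no; does)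
open import Relation.Nullary.Decidable using (dec-true; dec-false)

Sorted : List ℕ → Set
Sorted = AllPairs _<_

sorted⇒unique : ∀ {xs} → Sorted xs → Unique xs
sorted⇒unique = AllPairs.map <⇒≢

sorted⇒strictlyIncreasing : ∀ {xs} → Sorted xs → StrictlyIncreasing xs
sorted⇒strictlyIncreasing [] = []
sorted⇒strictlyIncreasing ([] ∷ []) = [-]
sorted⇒strictlyIncreasing ((x<y ∷ _) ∷ sorted@(_ ∷ _)) = x<y ∷ sorted⇒strictlyIncreasing sorted

strictlyIncreasing⇒sorted : ∀ {xs} → StrictlyIncreasing xs → Sorted xs
strictlyIncreasing⇒sorted [] = []
strictlyIncreasing⇒sorted [-] = [] ∷ []
strictlyIncreasing⇒sorted (x<y ∷ increasing) with strictlyIncreasing⇒sorted increasing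
... | y<ys ∷ sorted = (x<y ∷ All.map (<-trans x<y) y<ys) ∷ y<ys ∷ sorted

oneTo-sorted : ∀ n → Sorted (oneTo n)
oneTo-sorted n = AllPairs.map⁺ (AllPairs.map s<s (AllPairs.applyUpTo⁺₁ id n (λ i<j _ → i<j)))

↭-oneTo⇒unique : ∀ {n xs} → xs ↭ oneTo n → Unique xs
↭-oneTo⇒unique {n} xs↭ =
  Permutationₛ.Unique-resp-↭ (setoid ℕ) (↭⇒↭ₛ (↭-sym xs↭)) (sorted⇒unique (oneTo-sorted n))

≮∧≢⇒> : ∀ {x c} → ¬ x < c → x ≢ c → c < x
≮∧≢⇒> x≮c x≢c = ≤∧≢⇒< (≮⇒≥ x≮c) (x≢c ∘ sym)

∈-tail : ∀ {x y : ℕ} {ys} → x ∈ y ∷ ys → x ≢ y → x ∈ ys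
∈-tail (here x≡y) x≢y = ⊥-elim (x≢y x≡y)
∈-tail (there x∈ys) _ = x∈ys

sorted-heads-≡ : ∀ {k ks c K} → Sorted (k ∷ ks) → Sorted (c ∷ K) → c ∈ k ∷ ks → k ∈ c ∷ K → k ≡ c
sorted-heads-≡ _ _ _ (here k≡c) = k≡c
sorted-heads-≡ _ _ (here c≡k) (there _) = sym c≡k
sorted-heads-≡ (k<ks ∷ _) (c<K ∷ _) (there c∈ks) (there k∈K) =
  ⊥-elim (<-asym (All.lookup k<ks c∈ks) (All.lookup c<K k∈K))

unique-++⁻ : ∀ (u v : List ℕ) → Unique (u ++ v) → Unique u × All (_∉ v) u
unique-++⁻ [] v _ = [] , []
unique-++⁻ (x ∷ u) v (x≢uv ∷ unique) with unique-++⁻ u v unique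
... | uniqueU , u∉v =
  All.++⁻ˡ u x≢uv ∷ uniqueU , (λ x∈v → All.lookup (All.++⁻ʳ u x≢uv) x∈v refl) ∷ u∉v

rowReadingWord-∷ : ∀ R T → rowReadingWord (R ∷ T) ≡ rowReadingWord T ++ R
rowReadingWord-∷ R T = begin
  concat (reverse (R ∷ T))        ≡⟨ cong concat (unfold-reverse R T) ⟩
  concat (reverse T ++ R ∷ [])    ≡⟨ concat-++ (reverse T) (R ∷ []) ⟨
  concat (reverse T) ++ R ++ []   ≡⟨ cong (concat (reverse T) ++_) (++-identityʳ R) ⟩
  concat (reverse T) ++ R         ∎
  where open ≡-Reasoning

rowReadingWord-↭ : ∀ T → rowReadingWord T ↭ concat T
rowReadingWord-↭ [] = ↭-refl
rowReadingWord-↭ (R ∷ T) = begin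
  rowReadingWord (R ∷ T)  ≡⟨ rowReadingWord-∷ R T ⟩
  rowReadingWord T ++ R   ↭⟨ ++-comm (rowReadingWord T) R ⟩
  R ++ rowReadingWord T   ↭⟨ ++⁺ˡ R (rowReadingWord-↭ T) ⟩
  R ++ concat T           ∎
  where open PermutationReasoning

catMaybes-map-just : (R : List ℕ) → catMaybes (map just R) ≡ R
catMaybes-map-just [] = refl
catMaybes-map-just (r ∷ R) = cong (r ∷_) (catMaybes-map-just R)

catMaybes-gaps : ∀ g (c : Config) → catMaybes (replicate g nothing ++ c) ≡ catMaybes c
catMaybes-gaps zero c = refl
catMaybes-gaps (suc g) c = catMaybes-gaps g c

-- Row insertion

bump : ℕ → List ℕ → Maybe ℕ
bump x [] = nothing
bump x (c ∷ cs) with x <? c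
... | yes _ = just c
... | no _ = bump x cs

rowInsert : ℕ → List ℕ → List ℕ
rowInsert x [] = x ∷ []
rowInsert x (c ∷ cs) with x <? c
... | yes _ = x ∷ cs
... | no _ = c ∷ rowInsert x cs

∈-rowInsert⁻ : ∀ x K {k} → k ∈ rowInsert x K → k ≡ x ⊎ k ∈ K
∈-rowInsert⁻ x [] (here k≡x) = inj₁ k≡x
∈-rowInsert⁻ x (c ∷ cs) k∈ with x <? c | k∈
... | yes _ | here k≡x = inj₁ k≡x
... | yes _ | there k∈cs = inj₂ (there k∈cs)
... | no _ | here k≡c = inj₂ (here k≡c)
... | no _ | there k∈ins with ∈-rowInsert⁻ x cs k∈ins
...   | inj₁ k≡x = inj₁ k≡x
...   | inj₂ k∈cs = inj₂ (there k∈cs)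

∈-rowInsert⁺ : ∀ x K {k} → k ∈ K → bump x K ≢ just k → k ∈ rowInsert x K
∈-rowInsert⁺ x (c ∷ cs) k∈ not-bumped with x <? c | k∈
... | yes _ | here refl = ⊥-elim (not-bumped refl)
... | yes _ | there k∈cs = there k∈cs
... | no _ | here k≡c = here k≡c
... | no _ | there k∈cs = there (∈-rowInsert⁺ x cs k∈cs not-bumped)

x∈rowInsert : ∀ x K → x ∈ rowInsert x K
x∈rowInsert x [] = here refl
x∈rowInsert x (c ∷ cs) with x <? c
... | yes _ = here refl
... | no _ = there (x∈rowInsert x cs)

rowInsert-All : ∀ {P : ℕ → Set} x K → P x → All P K → All P (rowInsert x K)
rowInsert-All x K px pK = All.tabulate λ k∈ → [ (λ { refl → px }) , All.lookup pK ]′ (∈-rowInsert⁻ x K k∈)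

rowInsert-sorted : ∀ x K → Sorted K → x ∉ K → Sorted (rowInsert x K)
rowInsert-sorted x [] [] _ = [] ∷ []
rowInsert-sorted x (c ∷ cs) (c<cs ∷ sorted) x∉ with x <? c
... | yes x<c = All.map (<-trans x<c) c<cs ∷ sorted
... | no x≮c =
  rowInsert-All x cs (≮∧≢⇒> x≮c (x∉ ∘ here)) c<cs ∷ rowInsert-sorted x cs sorted (x∉ ∘ there)

rowInsert-nonempty : ∀ x K → NonEmpty (rowInsert x K)
rowInsert-nonempty x [] = s≤s z≤n
rowInsert-nonempty x (c ∷ cs) with x <? c
... | yes _ = s≤s z≤n
... | no _ = s≤s z≤n

bump-just : ∀ x K {b} → Sorted K → x ∉ K → bump x K ≡ just b →
  x < b × b ∈ K × (∀ {k} → x < k → k < b → k ∉ K) × b ∉ rowInsert x K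
bump-just x (c ∷ cs) (c<cs ∷ sorted) x∉ bumped with x <? c
bump-just x (c ∷ cs) (c<cs ∷ sorted) x∉ refl | yes x<c = x<c , here refl , below-c , c∉
  where
  below-c : ∀ {k} → x < k → k < c → k ∉ c ∷ cs
  below-c _ k<c (here refl) = <-irrefl refl k<c
  below-c _ k<c (there k∈cs) = <-asym k<c (All.lookup c<cs k∈cs)
  c∉ : c ∉ x ∷ cs
  c∉ (here refl) = <-irrefl refl x<c
  c∉ (there c∈cs) = <-irrefl refl (All.lookup c<cs c∈cs)
... | no x≮c with bump-just x cs sorted (x∉ ∘ there) bumped
...   | x<b , b∈cs , between , b∉ = x<b , there b∈cs , between′ , b∉′
  where
  c<x : c < x
  c<x = ≮∧≢⇒> x≮c (x∉ ∘ here)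
  between′ : ∀ {k} → x < k → k < _ → k ∉ c ∷ cs
  between′ x<k _ (here refl) = <-asym c<x x<k
  between′ x<k k<b (there k∈cs) = between x<k k<b k∈cs
  b∉′ : _ ∉ c ∷ rowInsert x cs
  b∉′ (here refl) = <-asym c<x x<b
  b∉′ (there b∈) = b∉ b∈

bump-nothing : ∀ x K → Sorted K → x ∉ K → bump x K ≡ nothing → ∀ {k} → x < k → k ∉ K
bump-nothing x (c ∷ cs) (_ ∷ sorted) x∉ none x<k k∈ with x <? c | k∈
... | no x≮c | here refl = <-asym (≮∧≢⇒> x≮c (x∉ ∘ here)) x<k
... | no _ | there k∈cs = bump-nothing x cs sorted (x∉ ∘ there) none x<k k∈cs

bumps : List ℕ → List ℕ → Config
bumps K [] = []
bumps K (x ∷ u) = bump x K ∷ bumps (rowInsert x K) u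

insertAll : List ℕ → List ℕ → List ℕ
insertAll = foldl (λ K x → rowInsert x K)

∈-insertAll⁻ : ∀ K u {k} → k ∈ insertAll K u → k ∈ K ⊎ k ∈ u
∈-insertAll⁻ K [] k∈ = inj₁ k∈
∈-insertAll⁻ K (x ∷ u) k∈ with ∈-insertAll⁻ (rowInsert x K) u k∈
... | inj₂ k∈u = inj₂ (there k∈u)
... | inj₁ k∈ins = [ inj₂ ∘ here , inj₁ ]′ (∈-rowInsert⁻ x K k∈ins)

insertAll-sorted : ∀ K u → Sorted K → Unique u → All (_∉ u) K → Sorted (insertAll K u)
insertAll-sorted K [] sortedK _ _ = sortedK
insertAll-sorted K (x ∷ u) sortedK (x≢u ∷ unique) K∉ =
  insertAll-sorted (rowInsert x K) u (rowInsert-sorted x K sortedK (λ x∈K → All.lookup K∉ x∈K (here refl))) unique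
    (rowInsert-All x K (λ x∈u → All.lookup x≢u x∈u refl) (All.map (_∘ there) K∉))

insertAll-nonempty : ∀ K u → NonEmpty K → NonEmpty (insertAll K u)
insertAll-nonempty K [] nonempty = nonempty
insertAll-nonempty K (x ∷ u) _ = insertAll-nonempty (rowInsert x K) u (rowInsert-nonempty x K)

bumps-++ : ∀ K u v → bumps K (u ++ v) ≡ bumps K u ++ bumps (insertAll K u) v
bumps-++ K [] v = refl
bumps-++ K (x ∷ u) v = cong (bump x K ∷_) (bumps-++ (rowInsert x K) u v)

insertAll-++ : ∀ K u v → insertAll K (u ++ v) ≡ insertAll (insertAll K u) v
insertAll-++ = foldl-++ (λ K x → rowInsert x K)

bump-lower : ∀ {x} P K → All (_< x) P → bump x (P ++ K) ≡ bump x K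
bump-lower [] K [] = refl
bump-lower {x} (p ∷ P) K (p<x ∷ P<x) with x <? p
... | yes x<p = ⊥-elim (<-asym x<p p<x)
... | no _ = bump-lower P K P<x

rowInsert-lower : ∀ {x} P K → All (_< x) P → rowInsert x (P ++ K) ≡ P ++ rowInsert x K
rowInsert-lower [] K [] = refl
rowInsert-lower {x} (p ∷ P) K (p<x ∷ P<x) with x <? p
... | yes x<p = ⊥-elim (<-asym x<p p<x)
... | no _ = cong (p ∷_) (rowInsert-lower P K P<x)

bumps-lower : ∀ P K u → All (λ x → All (_< x) P) u → bumps (P ++ K) u ≡ bumps K u
bumps-lower P K [] [] = refl
bumps-lower P K (x ∷ u) (P<x ∷ P<u) rewrite bump-lower P K P<x | rowInsert-lower P K P<x =
  cong (bump x K ∷_) (bumps-lower P (rowInsert x K) u P<u)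

insertAll-lower : ∀ P K u → All (λ x → All (_< x) P) u → insertAll (P ++ K) u ≡ P ++ insertAll K u
insertAll-lower P K [] [] = refl
insertAll-lower P K (x ∷ u) (P<x ∷ P<u) rewrite rowInsert-lower P K P<x =
  insertAll-lower P (rowInsert x K) u P<u

sorted⇒head-lower : ∀ {b B} → Sorted (b ∷ B) → All (λ x → All (_< x) (b ∷ [])) B
sorted⇒head-lower (b<B ∷ _) = All.map (_∷ []) b<B

-- The carrier

carry : List ℕ → Config → Config
carry K [] = map just K
carry K (nothing ∷ c) = head K ∷ carry (drop 1 K) c
carry K (just x ∷ c) = bump x K ∷ carry (rowInsert x K) c

carry-word : ∀ K u t → carry K (map just u ++ t) ≡ bumps K u ++ carry (insertAll K u) t
carry-word K [] t = refl
carry-word K (x ∷ u) t = cong (bump x K ∷_) (carry-word (rowInsert x K) u t)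

-- `sweep held ks c` moves the balls ks one after another as in a BBS move,
-- except that a ball k with `held k` is in the carrier rather than in c:
-- moving it just drops it into the first empty box.
advance : (ℕ → Bool) → ℕ → Config → Config
advance held k d = if held k then place k d else moveBall k d

sweep : (ℕ → Bool) → List ℕ → Config → Config
sweep held ks c = foldl (λ d k → advance held k d) c ks

inHand : List ℕ → ℕ → Bool
inHand K k = does (k ∈? K)

advance-held : ∀ held k d → held k ≡ true → advance held k d ≡ place k d
advance-held held k d held-k rewrite held-k = refl

advance-free : ∀ held k d → held k ≡ false → advance held k d ≡ moveBall k d
advance-free held k d free-k rewrite free-k = refl

advance-cong : ∀ held held′ k d → held k ≡ held′ k → advance held k d ≡ advance held′ k d
advance-cong held held′ k d agree rewrite agree = refl

∈-place⁻ : ∀ k d {m} → m ∈ catMaybes (place k d) → m ≡ k ⊎ m ∈ catMaybes d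
∈-place⁻ k [] (here m≡k) = inj₁ m≡k
∈-place⁻ k (nothing ∷ d) (here m≡k) = inj₁ m≡k
∈-place⁻ k (nothing ∷ d) (there m∈d) = inj₂ m∈d
∈-place⁻ k (just y ∷ d) (here m≡y) = inj₂ (here m≡y)
∈-place⁻ k (just y ∷ d) (there m∈) with ∈-place⁻ k d m∈
... | inj₁ m≡k = inj₁ m≡k
... | inj₂ m∈d = inj₂ (there m∈d)

∈-moveBall⁻ : ∀ k d {m} → m ∈ catMaybes (moveBall k d) → m ≡ k ⊎ m ∈ catMaybes d
∈-moveBall⁻ k (nothing ∷ d) m∈ = ∈-moveBall⁻ k d m∈
∈-moveBall⁻ k (just y ∷ d) m∈ with y ≟ k | m∈
... | yes _ | m∈′ with ∈-place⁻ k d m∈′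
...   | inj₁ m≡k = inj₁ m≡k
...   | inj₂ m∈d = inj₂ (there m∈d)
∈-moveBall⁻ k (just y ∷ d) m∈ | no _ | here m≡y = inj₂ (here m≡y)
∈-moveBall⁻ k (just y ∷ d) m∈ | no _ | there m∈′ with ∈-moveBall⁻ k d m∈′
...   | inj₁ m≡k = inj₁ m≡k
...   | inj₂ m∈d = inj₂ (there m∈d)

∉-place : ∀ k d {m} → m ≢ k → m ∉ catMaybes d → m ∉ catMaybes (place k d)
∉-place k d m≢k m∉d m∈ = [ m≢k , m∉d ]′ (∈-place⁻ k d m∈)

∉-moveBall : ∀ k d {m} → m ≢ k → m ∉ catMaybes d → m ∉ catMaybes (moveBall k d)
∉-moveBall k d m≢k m∉d m∈ = [ m≢k , m∉d ]′ (∈-moveBall⁻ k d m∈)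

∉-advance : ∀ held k d {m} → m ≢ k → m ∉ catMaybes d → m ∉ catMaybes (advance held k d)
∉-advance held k d with held k
... | true = ∉-place k d
... | false = ∉-moveBall k d

moveBall-absent : ∀ k d → k ∉ catMaybes d → moveBall k d ≡ d
moveBall-absent k [] _ = refl
moveBall-absent k (nothing ∷ d) k∉ = cong (nothing ∷_) (moveBall-absent k d k∉)
moveBall-absent k (just y ∷ d) k∉ with y ≟ k
... | yes refl = ⊥-elim (k∉ (here refl))
... | no _ = cong (just y ∷_) (moveBall-absent k d (k∉ ∘ there))

moveBall-first : ∀ x d → moveBall x (just x ∷ d) ≡ nothing ∷ place x d
moveBall-first x d with x ≟ x
... | yes _ = refl
... | no x≢x = ⊥-elim (x≢x refl)

advance-past : ∀ held k y d → k ≢ y → advance held k (just y ∷ d) ≡ just y ∷ advance held k d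
advance-past held k y d k≢y with held k | y ≟ k
... | true | _ = refl
... | false | yes refl = ⊥-elim (k≢y refl)
... | false | no _ = refl

sweep-idle : ∀ held held′ ks d → All (λ k → held k ≡ false) ks → All (λ k → held′ k ≡ false) ks →
  sweep held ks (nothing ∷ d) ≡ nothing ∷ sweep held′ ks d
sweep-idle held held′ [] d [] [] = refl
sweep-idle held held′ (k ∷ ks) d (free ∷ frees) (free′ ∷ frees′)
  rewrite advance-free held k (nothing ∷ d) free | advance-free held′ k d free′
  = sweep-idle held held′ ks (moveBall k d) frees frees′

sweep-past : ∀ held held′ ks y d → All (_≢ y) ks → All (λ k → held k ≡ held′ k) ks →
  sweep held ks (just y ∷ d) ≡ just y ∷ sweep held′ ks d
sweep-past held held′ [] y d [] [] = refl
sweep-past held held′ (k ∷ ks) y d (k≢y ∷ ≢y) (agree ∷ agrees)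
  rewrite advance-past held k y d k≢y | advance-cong held held′ k d agree
  = sweep-past held held′ ks y (advance held′ k d) ≢y agrees

sweep-fill : ∀ held held′ b ks d → Sorted ks → b ∈ ks → held b ≡ true → held′ b ≡ false →
  All (λ k → k < b → held k ≡ false) ks → All (λ k → k ≢ b → held k ≡ held′ k) ks →
  b ∉ catMaybes d →
  sweep held ks (nothing ∷ d) ≡ just b ∷ sweep held′ ks d
sweep-fill held held′ b (b ∷ ks) d (b<ks ∷ _) (here refl) held-b free′-b _ (_ ∷ agrees) b∉d
  rewrite advance-held held b (nothing ∷ d) held-b | advance-free held′ b d free′-b | moveBall-absent b d b∉d
  = sweep-past held held′ ks b d (All.map (λ b<k → <⇒≢ b<k ∘ sym) b<ks)
      (All.zipWith (λ (b<k , agree) → agree (<⇒≢ b<k ∘ sym)) (b<ks , agrees))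
sweep-fill held held′ b (k ∷ ks) d (k<ks ∷ sorted) (there b∈ks) held-b free′-b
           (free ∷ frees) (agree ∷ agrees) b∉d
  with All.lookup k<ks b∈ks
... | k<b
  rewrite advance-free held k (nothing ∷ d) (free k<b)
        | advance-free held′ k d (trans (sym (agree (<⇒≢ k<b))) (free k<b))
  = sweep-fill held held′ b ks (moveBall k d) sorted b∈ks held-b free′-b frees agrees
      (∉-moveBall k d (<⇒≢ k<b ∘ sym) b∉d)

sweep-exchange : ∀ held held′ x b ks d → Sorted ks → x ∈ ks → b ∈ ks → x < b →
  held x ≡ false → held′ x ≡ true → held b ≡ true → held′ b ≡ false →
  All (λ k → x < k → k < b → held k ≡ false) ks →
  All (λ k → k ≢ x → k ≢ b → held k ≡ held′ k) ks →
  x ∉ catMaybes d → b ∉ catMaybes d →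
  sweep held ks (just x ∷ d) ≡ just b ∷ sweep held′ ks d
sweep-exchange held held′ x b (x ∷ ks) d (x<ks ∷ sorted) (here refl) b∈ x<b
               free-x held′-x held-b free′-b (_ ∷ between) (_ ∷ agrees) x∉d b∉d
  rewrite advance-free held x (just x ∷ d) free-x | moveBall-first x d | advance-held held′ x d held′-x
  = sweep-fill held held′ b ks (place x d) sorted (∈-tail b∈ (<⇒≢ x<b ∘ sym)) held-b free′-b
      (All.zipWith (λ (x<k , free) → free x<k) (x<ks , between))
      (All.zipWith (λ (x<k , agree) → agree (<⇒≢ x<k ∘ sym)) (x<ks , agrees))
      (∉-place x d (<⇒≢ x<b ∘ sym) b∉d)
sweep-exchange held held′ x b (k ∷ ks) d (k<ks ∷ sorted) (there x∈ks) b∈ x<b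
               free-x held′-x held-b free′-b (_ ∷ between) (agree ∷ agrees) x∉d b∉d
  with All.lookup k<ks x∈ks
... | k<x
  with k<b ← <-trans k<x x<b
  rewrite advance-past held k x d (<⇒≢ k<x) | advance-cong held held′ k d (agree (<⇒≢ k<x) (<⇒≢ k<b))
  = sweep-exchange held held′ x b ks (advance held′ k d) sorted x∈ks (∈-tail b∈ (<⇒≢ k<b ∘ sym)) x<b
      free-x held′-x held-b free′-b between agrees
      (∉-advance held′ k d (<⇒≢ k<x ∘ sym) x∉d) (∉-advance held′ k d (<⇒≢ k<b ∘ sym) b∉d)

sweep-vacate : ∀ held held′ x ks d → Sorted ks → x ∈ ks → held x ≡ false → held′ x ≡ true →
  All (λ k → x < k → held k ≡ false) ks → All (λ k → k ≢ x → held k ≡ held′ k) ks →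
  x ∉ catMaybes d →
  sweep held ks (just x ∷ d) ≡ nothing ∷ sweep held′ ks d
sweep-vacate held held′ x (x ∷ ks) d (x<ks ∷ _) (here refl) free-x held′-x (_ ∷ above) (_ ∷ agrees) _
  rewrite advance-free held x (just x ∷ d) free-x | moveBall-first x d | advance-held held′ x d held′-x
  = sweep-idle held held′ ks (place x d) frees
      (All.zipWith (λ (free , agree) → trans (sym agree) free) (frees , agrees′))
  where
  frees : All (λ k → held k ≡ false) ks
  frees = All.zipWith (λ (x<k , free) → free x<k) (x<ks , above)
  agrees′ : All (λ k → held k ≡ held′ k) ks
  agrees′ = All.zipWith (λ (x<k , agree) → agree (<⇒≢ x<k ∘ sym)) (x<ks , agrees)
sweep-vacate held held′ x (k ∷ ks) d (k<ks ∷ sorted) (there x∈ks) free-x held′-x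
             (_ ∷ above) (agree ∷ agrees) x∉d
  with All.lookup k<ks x∈ks
... | k<x
  rewrite advance-past held k x d (<⇒≢ k<x) | advance-cong held held′ k d (agree (<⇒≢ k<x))
  = sweep-vacate held held′ x ks (advance held′ k d) sorted x∈ks free-x held′-x above agrees
      (∉-advance held′ k d (<⇒≢ k<x ∘ sym) x∉d)

inHand-∈ : ∀ K {k} → k ∈ K → inHand K k ≡ true
inHand-∈ K {k} = dec-true (k ∈? K)

inHand-∉ : ∀ K {k} → k ∉ K → inHand K k ≡ false
inHand-∉ K {k} = dec-false (k ∈? K)

inHand-cong : ∀ {k K K′} → (k ∈ K → k ∈ K′) → (k ∈ K′ → k ∈ K) → inHand K k ≡ inHand K′ k
inHand-cong {k} {K} {K′} to from with k ∈? K′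
... | yes k∈K′ = inHand-∈ K (from k∈K′)
... | no k∉K′ = inHand-∉ K (k∉K′ ∘ to)

inHand-∷ : ∀ {k c K} → k ≢ c → inHand (c ∷ K) k ≡ inHand K k
inHand-∷ {K = K} k≢c = inHand-cong {K′ = K} (λ k∈ → ∈-tail k∈ k≢c) there

inHand-rowInsert : ∀ x K {k} → k ≢ x → bump x K ≢ just k → inHand (rowInsert x K) k ≡ inHand K k
inHand-rowInsert x K {k} k≢x not-bumped = inHand-cong {K′ = K}
  (λ k∈ → [ (λ k≡x → ⊥-elim (k≢x k≡x)) , id ]′ (∈-rowInsert⁻ x K k∈))
  (λ k∈K → ∈-rowInsert⁺ x K k∈K not-bumped)

sweep-unload : ∀ ks K → Sorted ks → Sorted K → All (_∈ ks) K → sweep (inHand K) ks [] ≡ map just K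
sweep-unload [] [] _ _ _ = refl
sweep-unload [] (c ∷ K) _ _ (() ∷ _)
sweep-unload (k ∷ ks) K (k<ks ∷ sorted) sortedK K⊆ with k ∈? K
... | no k∉K = sweep-unload ks K sorted sortedK
                 (All.tabulate λ c∈K → ∈-tail (All.lookup K⊆ c∈K) λ { refl → k∉K c∈K })
sweep-unload (k ∷ ks) (c ∷ K) (k<ks ∷ sorted) (c<K ∷ sortedK) (c∈ ∷ K⊆) | yes k∈
  with sorted-heads-≡ (k<ks ∷ sorted) (c<K ∷ sortedK) c∈ k∈
... | refl = trans
  (sweep-past (inHand (k ∷ K)) (inHand K) ks k [] k≢ks (All.map (inHand-∷ {K = K}) k≢ks))
  (cong (just k ∷_) (sweep-unload ks K sorted sortedK
     (All.zipWith (λ (k<c′ , c′∈) → ∈-tail c′∈ (<⇒≢ k<c′ ∘ sym)) (c<K , K⊆))))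
  where
  k≢ks : All (_≢ k) ks
  k≢ks = All.map (λ k<k′ → <⇒≢ k<k′ ∘ sym) k<ks

sweep-gap : ∀ ks K d → Sorted ks → Sorted K → All (_∈ ks) K → All (_∉ catMaybes d) K →
  sweep (inHand K) ks (nothing ∷ d) ≡ head K ∷ sweep (inHand (drop 1 K)) ks d
sweep-gap ks [] d _ _ _ _ = sweep-idle (inHand []) (inHand []) ks d frees frees
  where
  frees : All (λ k → inHand [] k ≡ false) ks
  frees = All.tabulate λ _ → refl
sweep-gap ks (b ∷ K) d sorted (b<K ∷ _) (b∈ ∷ _) (b∉d ∷ _) =
  sweep-fill (inHand (b ∷ K)) (inHand K) b ks d sorted b∈ (inHand-∈ (b ∷ K) (here refl)) (inHand-∉ K b∉K)
    (All.tabulate λ _ k<b → inHand-∉ (b ∷ K) (k∉ k<b)) (All.tabulate λ _ k≢b → inHand-∷ {K = K} k≢b) b∉d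
  where
  b∉K : b ∉ K
  b∉K = <-irrefl refl ∘ All.lookup b<K
  k∉ : ∀ {k} → k < b → k ∉ b ∷ K
  k∉ k<b (here refl) = <-irrefl refl k<b
  k∉ k<b (there k∈K) = <-asym k<b (All.lookup b<K k∈K)

sweep-ball : ∀ ks K x d → Sorted ks → Sorted K → All (_∈ ks) K → x ∈ ks → x ∉ K → x ∉ catMaybes d →
  All (_∉ catMaybes d) K →
  sweep (inHand K) ks (just x ∷ d) ≡ bump x K ∷ sweep (inHand (rowInsert x K)) ks d
sweep-ball ks K x d sorted sortedK K⊆ x∈ x∉K x∉d K∉d with bump x K in bumped
... | just b with bump-just x K sortedK x∉K bumped
...   | x<b , b∈K , between , b∉ =
  sweep-exchange (inHand K) (inHand (rowInsert x K)) x b ks d sorted x∈ (All.lookup K⊆ b∈K) x<b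
    (inHand-∉ K x∉K) (inHand-∈ (rowInsert x K) (x∈rowInsert x K))
    (inHand-∈ K b∈K) (inHand-∉ (rowInsert x K) b∉)
    (All.tabulate λ _ x<k k<b → inHand-∉ K (between x<k k<b))
    (All.tabulate λ _ k≢x k≢b →
       sym (inHand-rowInsert x K k≢x λ e → k≢b (just-injective (trans (sym e) bumped))))
    x∉d (All.lookup K∉d b∈K)
sweep-ball ks K x d sorted sortedK K⊆ x∈ x∉K x∉d K∉d | nothing =
  sweep-vacate (inHand K) (inHand (rowInsert x K)) x ks d sorted x∈
    (inHand-∉ K x∉K) (inHand-∈ (rowInsert x K) (x∈rowInsert x K))
    (All.tabulate λ _ x<k → inHand-∉ K (bump-nothing x K sortedK x∉K bumped x<k))
    (All.tabulate λ _ k≢x → sym (inHand-rowInsert x K k≢x λ e → nothing≢just (trans (sym bumped) e)))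
    x∉d
  where
  nothing≢just : ∀ {k : ℕ} → nothing ≢ just k
  nothing≢just ()

sweep≡carry : ∀ ks K c → Sorted ks → Sorted K → All (_∈ ks) K → All (_∈ ks) (catMaybes c) →
  Unique (catMaybes c) → All (_∉ catMaybes c) K → sweep (inHand K) ks c ≡ carry K c
sweep≡carry ks K [] sorted sortedK K⊆ _ _ _ = sweep-unload ks K sorted sortedK K⊆
sweep≡carry ks K (nothing ∷ d) sorted sortedK K⊆ d⊆ unique K∉d =
  trans (sweep-gap ks K d sorted sortedK K⊆ K∉d)
        (cong (head K ∷_) (sweep≡carry ks (drop 1 K) d sorted (AllPairs.drop⁺ 1 sortedK)
           (All.drop⁺ 1 K⊆) d⊆ unique (All.drop⁺ 1 K∉d)))
sweep≡carry ks K (just x ∷ d) sorted sortedK K⊆ (x∈ ∷ d⊆) (x≢d ∷ unique) K∉ =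
  trans (sweep-ball ks K x d sorted sortedK K⊆ x∈ x∉K x∉d (All.map (_∘ there) K∉))
        (cong (bump x K ∷_) (sweep≡carry ks (rowInsert x K) d sorted (rowInsert-sorted x K sortedK x∉K)
           (rowInsert-All x K x∈ K⊆) d⊆ unique (rowInsert-All x K x∉d (All.map (_∘ there) K∉))))
  where
  x∉K : x ∉ K
  x∉K x∈K = All.lookup K∉ x∈K (here refl)
  x∉d : x ∉ catMaybes d
  x∉d x∈d = All.lookup x≢d x∈d refl

bbsMove≡carry : ∀ n c → catMaybes c ↭ oneTo n → bbsMove n c ≡ carry [] c
-- `bbsMove n` is definitionally `sweep (inHand []) (oneTo n)`.
bbsMove≡carry n c balls↭ = sweep≡carry (oneTo n) [] c (oneTo-sorted n) [] []
  (All.tabulate (∈-resp-↭ balls↭)) (↭-oneTo⇒unique balls↭) []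

-- Rows separated by empty boxes

rowPairOK-[] : ∀ B → RowPairOK B []
rowPairOK-[] [] = z≤n , []
rowPairOK-[] (_ ∷ _) = z≤n , []

rowPairOK-tail : ∀ {a A} B → Sorted (a ∷ A) → RowPairOK B (a ∷ A) → RowPairOK B A
rowPairOK-tail [] _ (() , _)
rowPairOK-tail {A = []} B _ _ = rowPairOK-[] B
rowPairOK-tail {A = a′ ∷ A} (b ∷ B) ((a<a′ ∷ _) ∷ sorted) (s≤s len , b<a ∷ col) =
  ≤-trans len (n≤1+n _) , <-trans b<a a<a′ ∷ proj₂ (rowPairOK-tail B sorted (len , col))

bumps-row : ∀ S B → Sorted B → RowPairOK B S → ∃ λ m → bumps S B ≡ map just S ++ replicate m nothing
bumps-row [] [] _ _ = 0 , refl
bumps-row (s ∷ S) [] _ (() , _)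
bumps-row [] (b ∷ B) sorted@(_ ∷ sortedB) _ with bumps-row [] B sortedB (rowPairOK-[] B)
... | m , bumps≡ =
  suc m , cong (nothing ∷_) (trans (bumps-lower (b ∷ []) [] B (sorted⇒head-lower sorted)) bumps≡)
bumps-row (s ∷ S) (b ∷ B) sorted@(_ ∷ sortedB) (s≤s len , b<s ∷ col)
  with b <? s | bumps-row S B sortedB (len , col)
... | no b≮s | _ = ⊥-elim (b≮s b<s)
... | yes _ | m , bumps≡ =
  m , cong (just s ∷_) (trans (bumps-lower (b ∷ []) S B (sorted⇒head-lower sorted)) bumps≡)

insertAll-row : ∀ S B → Sorted B → RowPairOK B S → insertAll S B ≡ B
insertAll-row [] [] _ _ = refl
insertAll-row (s ∷ S) [] _ (() , _)
insertAll-row [] (b ∷ B) sorted@(_ ∷ sortedB) _ =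
  trans (insertAll-lower (b ∷ []) [] B (sorted⇒head-lower sorted))
        (cong (b ∷_) (insertAll-row [] B sortedB (rowPairOK-[] B)))
insertAll-row (s ∷ S) (b ∷ B) sorted@(_ ∷ sortedB) (s≤s len , b<s ∷ col) with b <? s
... | no b≮s = ⊥-elim (b≮s b<s)
... | yes _ =
  trans (insertAll-lower (b ∷ []) S B (sorted⇒head-lower sorted))
        (cong (b ∷_) (insertAll-row S B sortedB (len , col)))

carry-gaps-row : ∀ g A B t → Sorted A → Sorted B → RowPairOK B A →
  ∃ λ m → carry A (replicate g nothing ++ map just B ++ t) ≡ map just A ++ replicate m nothing ++ carry B t
carry-gaps-row zero A B t _ sortedB rowOK with bumps-row A B sortedB rowOK
... | m , bumps≡ = m , (begin
  carry A (map just B ++ t)                         ≡⟨ carry-word A B t ⟩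
  bumps A B ++ carry (insertAll A B) t              ≡⟨ cong₂ _++_ bumps≡ (cong (λ K → carry K t) inserted) ⟩
  (map just A ++ replicate m nothing) ++ carry B t  ≡⟨ ++-assoc (map just A) (replicate m nothing) _ ⟩
  map just A ++ replicate m nothing ++ carry B t    ∎)
  where
  open ≡-Reasoning
  inserted : insertAll A B ≡ B
  inserted = insertAll-row A B sortedB rowOK
carry-gaps-row (suc g) [] B t _ sortedB rowOK with carry-gaps-row g [] B t [] sortedB rowOK
... | m , carry≡ = suc m , cong (nothing ∷_) carry≡
carry-gaps-row (suc g) (a ∷ A) B t sortedA@(_ ∷ sortedA′) sortedB rowOK
  with carry-gaps-row g A B t sortedA′ sortedB (rowPairOK-tail B sortedA rowOK)
... | m , carry≡ = m , cong (just a ∷_) carry≡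

data Blocks : List (List ℕ) → Config → Set where
  [] : Blocks [] []
  gap-row : ∀ {W t} g R → Blocks W t → Blocks (R ∷ W) (replicate g nothing ++ map just R ++ t)

data StackedOn : List ℕ → List (List ℕ) → Set where
  [] : ∀ {A} → StackedOn A []
  stack : ∀ {A R W} → RowPairOK R A → Sorted R → NonEmpty R → StackedOn R W → StackedOn A (R ∷ W)

carry-blocks : ∀ A W c → Sorted A → StackedOn A W → Blocks W c →
  ∃ λ c′ → carry A c ≡ map just A ++ c′ × Blocks W c′
carry-blocks A [] [] _ [] [] = [] , sym (++-identityʳ _) , []
carry-blocks A (R ∷ W) _ sortedA (stack rowOK sortedR _ stacked) (gap-row {t = t} g R blocks)
  with carry-gaps-row g A R t sortedA sortedR rowOK | carry-blocks R W t sortedR stacked blocks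
... | m , carry≡ | c′ , carry≡′ , blocks′ =
  replicate m nothing ++ map just R ++ c′ ,
  trans carry≡ (cong (λ c → map just A ++ replicate m nothing ++ c) carry≡′) ,
  gap-row m R blocks′

catMaybes-blocks : ∀ {W c} → Blocks W c → catMaybes c ≡ concat W
catMaybes-blocks [] = refl
catMaybes-blocks (gap-row {t = t} g R blocks) = begin
  catMaybes (replicate g nothing ++ map just R ++ t) ≡⟨ catMaybes-gaps g _ ⟩
  catMaybes (map just R ++ t)                        ≡⟨ catMaybes-++ (map just R) t ⟩
  catMaybes (map just R) ++ catMaybes t              ≡⟨ cong₂ _++_ (catMaybes-map-just R) (catMaybes-blocks blocks) ⟩
  R ++ _                                             ∎
  where open ≡-Reasoning

packed-blocks : ∀ W → Blocks W (map just (concat W))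
packed-blocks [] = []
packed-blocks (R ∷ W) = subst (Blocks (R ∷ W)) (sym (map-++ just R (concat W))) (gap-row 0 R (packed-blocks W))

-- `runs` is `runsAux []` for a private `runsAux` of Defs; the meta below is
-- solved to `runsAux` by unification, which makes its clauses available here.
mutual
  runsFrom : List ℕ → Config → List (List ℕ)
  runsFrom = _

  runs≡runsFrom : ∀ c → runs c ≡ runsFrom [] c
  runs≡runsFrom c with (List ℕ ∋ [])
  ... | _ = refl

runsFrom-gaps : ∀ g c → runsFrom [] (replicate g nothing ++ c) ≡ runsFrom [] c
runsFrom-gaps zero c = refl
runsFrom-gaps (suc g) c = runsFrom-gaps g c

data RunBreak (p : ℕ) : Config → Set where
  end : RunBreak p []
  gap : ∀ {t} → RunBreak p (nothing ∷ t)
  smaller : ∀ {b t} → b < p → RunBreak p (just b ∷ t)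

runsFrom-row : ∀ p₀ p cur R t → p₀ ≤ p → Sorted (p ∷ R) → RunBreak p₀ t →
  runsFrom (p ∷ cur) (map just R ++ t) ≡ reverse (R ʳ++ (p ∷ cur)) ∷ runsFrom [] t
runsFrom-row p₀ p cur [] [] _ _ end = refl
runsFrom-row p₀ p cur [] (nothing ∷ t) _ _ gap = refl
runsFrom-row p₀ p cur [] (just b ∷ t) p₀≤p _ (smaller b<p₀) with p <? b
... | yes p<b = ⊥-elim (<-asym b<p₀ (≤-<-trans p₀≤p p<b))
... | no _ = refl
runsFrom-row p₀ p cur (r ∷ R) t p₀≤p ((p<r ∷ _) ∷ sorted) break with p <? r
... | yes _ = runsFrom-row p₀ r (p ∷ cur) R t (≤-trans p₀≤p (<⇒≤ p<r)) sorted break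
... | no p≮r = ⊥-elim (p≮r p<r)

stacked-break : ∀ {a A W t} → StackedOn (a ∷ A) W → Blocks W t → RunBreak a t
stacked-break [] [] = end
stacked-break (stack _ _ () _) (gap-row zero [] _)
stacked-break (stack (_ , b<a ∷ _) _ _ _) (gap-row zero (b ∷ B) _) = smaller b<a
stacked-break _ (gap-row (suc g) R _) = gap

runs-blocks : ∀ {A W c} → StackedOn A W → Blocks W c → runs c ≡ W
runs-blocks [] [] = refl
runs-blocks (stack _ _ () _) (gap-row g [] _)
runs-blocks (stack _ sortedR _ stacked) (gap-row {t = t} g (r ∷ R) blocks) = begin
  runs c                                     ≡⟨ runs≡runsFrom c ⟩
  runsFrom [] c                              ≡⟨ runsFrom-gaps g _ ⟩
  runsFrom (r ∷ []) (map just R ++ t)        ≡⟨ runsFrom-row r r [] R t ≤-refl sortedR (stacked-break stacked blocks) ⟩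
  reverse (reverse (r ∷ R)) ∷ runsFrom [] t  ≡⟨ cong₂ _∷_ (reverse-involutive (r ∷ R)) (runs-blocks stacked blocks) ⟩
  (r ∷ R) ∷ _                                ∎
  where
  open ≡-Reasoning
  c : Config
  c = replicate g nothing ++ map just (r ∷ R) ++ t

concat-runsFrom : ∀ acc c → concat (runsFrom acc c) ≡ reverse acc ++ catMaybes c
concat-runsFrom [] [] = refl
concat-runsFrom (_ ∷ _) [] = refl
concat-runsFrom [] (nothing ∷ c) = concat-runsFrom [] c
concat-runsFrom acc@(_ ∷ _) (nothing ∷ c) = cong (reverse acc ++_) (concat-runsFrom [] c)
concat-runsFrom [] (just m ∷ c) = concat-runsFrom (m ∷ []) c
concat-runsFrom (p ∷ cur) (just m ∷ c) with p <? m
... | yes _ = begin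
  concat (runsFrom (m ∷ p ∷ cur) c)               ≡⟨ concat-runsFrom (m ∷ p ∷ cur) c ⟩
  reverse (m ∷ p ∷ cur) ++ catMaybes c            ≡⟨ cong (_++ catMaybes c) (unfold-reverse m (p ∷ cur)) ⟩
  (reverse (p ∷ cur) ++ m ∷ []) ++ catMaybes c    ≡⟨ ++-assoc (reverse (p ∷ cur)) (m ∷ []) (catMaybes c) ⟩
  reverse (p ∷ cur) ++ m ∷ catMaybes c            ∎
  where open ≡-Reasoning
... | no _ = cong (reverse (p ∷ cur) ++_) (concat-runsFrom (m ∷ []) c)

concat-runs : ∀ c → concat (runs c) ≡ catMaybes c
concat-runs c = trans (cong concat (runs≡runsFrom c)) (concat-runsFrom [] c)

-- Reading words are steady

stacked-reverse : ∀ R T acc →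
  ConsecutiveRowsOK (R ∷ T) → All NonEmpty (R ∷ T) → All StrictlyIncreasing (R ∷ T) →
  StackedOn R acc → StackedOn [] (T ʳ++ (R ∷ acc))
stacked-reverse R [] acc _ (nonempty ∷ _) (increasing ∷ _) stacked =
  stack (rowPairOK-[] R) (strictlyIncreasing⇒sorted increasing) nonempty stacked
stacked-reverse R (R′ ∷ T) acc (rowOK ∷ rows) (nonempty ∷ nonempties) (increasing ∷ increasings) stacked =
  stacked-reverse R′ T (R ∷ acc) rows nonempties increasings
    (stack rowOK (strictlyIncreasing⇒sorted increasing) nonempty stacked)

tableau-stacked : ∀ {n} T → IsStandardTableau n T → StackedOn [] (reverse T)
tableau-stacked [] _ = []
tableau-stacked (R ∷ T) (nonempties , increasings , rows , _) =
  stacked-reverse R T [] rows nonempties increasings []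

bbsIter-blocks : ∀ n W → StackedOn [] W → concat W ↭ oneTo n →
  ∀ s → Blocks W (bbsIter n s (initial (concat W)))
bbsIter-blocks n W stacked content zero = packed-blocks W
bbsIter-blocks n W stacked content (suc s)
  with blocks ← bbsIter-blocks n W stacked content s
  with carry-blocks [] W _ [] stacked blocks
... | c′ , carry≡ , blocks′ = subst (Blocks W) (sym (trans (bbsMove≡carry n _ balls↭) carry≡)) blocks′
  where
  balls↭ : catMaybes (bbsIter n s (initial (concat W))) ↭ oneTo n
  balls↭ = subst (_↭ oneTo n) (sym (catMaybes-blocks blocks)) content

readingWord⇒steadyState : ∀ n T → IsStandardTableau n T → SteadyStateTimeZero n (rowReadingWord T)
readingWord⇒steadyState n T tableau@(_ , _ , _ , content) s =
  trans (runs-blocks stacked (blocks s)) (sym (runs-blocks stacked (blocks 0)))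
  where
  stacked : StackedOn [] (reverse T)
  stacked = tableau-stacked T tableau
  blocks : ∀ s → Blocks (reverse T) (bbsIter n s (initial (rowReadingWord T)))
  blocks = bbsIter-blocks n (reverse T) stacked (↭-trans (rowReadingWord-↭ T) content)

-- Steady words are reading words

-- One move of `initial r` keeps the left-to-right order of the balls.
Stable : List ℕ → Set
Stable r = catMaybes (bumps [] r) ++ insertAll [] r ≡ r

catMaybes-carry-packed : ∀ r → catMaybes (carry [] (initial r)) ≡ catMaybes (bumps [] r) ++ insertAll [] r
catMaybes-carry-packed r = begin
  catMaybes (carry [] (map just r))                      ≡⟨ cong (catMaybes ∘ carry []) (++-identityʳ (map just r)) ⟨
  catMaybes (carry [] (map just r ++ []))                ≡⟨ cong catMaybes (carry-word [] r []) ⟩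
  catMaybes (bumps [] r ++ map just v)                   ≡⟨ catMaybes-++ (bumps [] r) _ ⟩
  catMaybes (bumps [] r) ++ catMaybes (map just v)       ≡⟨ cong (catMaybes (bumps [] r) ++_) (catMaybes-map-just v) ⟩
  catMaybes (bumps [] r) ++ v                            ∎
  where
  open ≡-Reasoning
  v : List ℕ
  v = insertAll [] r

steadyState⇒stable : ∀ n r → IsPerm n r → SteadyStateTimeZero n r → Stable r
steadyState⇒stable n r perm steady = begin
  catMaybes (bumps [] r) ++ insertAll [] r  ≡⟨ catMaybes-carry-packed r ⟨
  catMaybes (carry [] (initial r))          ≡⟨ cong catMaybes (bbsMove≡carry n (initial r) balls↭) ⟨
  catMaybes (bbsMove n (initial r))         ≡⟨ concat-runs (bbsMove n (initial r)) ⟨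
  concat (runs (bbsMove n (initial r)))     ≡⟨ cong concat (steady 1) ⟩
  concat (runs (initial r))                 ≡⟨ concat-runs (initial r) ⟩
  catMaybes (initial r)                     ≡⟨ catMaybes-map-just r ⟩
  r                                         ∎
  where
  open ≡-Reasoning
  balls↭ : catMaybes (initial r) ↭ oneTo n
  balls↭ = subst (_↭ oneTo n) (sym (catMaybes-map-just r)) perm

fixed-insertion : ∀ C v → Sorted C → Sorted v → All (_∉ v) C → insertAll C v ≡ v →
  catMaybes (bumps C v) ≡ C × RowPairOK v C
fixed-insertion [] [] _ _ _ _ = refl , z≤n , []
fixed-insertion (c ∷ C) [] _ _ _ ()
fixed-insertion [] (x ∷ v) _ sorted@(_ ∷ sortedV) _ fixed
  with fixed-insertion [] v [] sortedV []
         (∷-injectiveʳ (trans (sym (insertAll-lower (x ∷ []) [] v (sorted⇒head-lower sorted))) fixed))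
... | bumped , _ =
  trans (cong catMaybes (bumps-lower (x ∷ []) [] v (sorted⇒head-lower sorted))) bumped , rowPairOK-[] (x ∷ v)
fixed-insertion (c ∷ C) (x ∷ v) (_ ∷ sortedC) sorted@(_ ∷ sortedV) (c∉ ∷ C∉) fixed with x <? c
... | yes x<c with fixed-insertion C v sortedC sortedV (All.map (_∘ there) C∉)
         (∷-injectiveʳ (trans (sym (insertAll-lower (x ∷ []) C v (sorted⇒head-lower sorted))) fixed))
...   | bumped , len , col =
  cong (c ∷_) (trans (cong catMaybes (bumps-lower (x ∷ []) C v (sorted⇒head-lower sorted))) bumped) ,
  s≤s len , x<c ∷ col
fixed-insertion (c ∷ C) (x ∷ v) _ (x<v ∷ _) (c∉ ∷ _) fixed | no x≮c =
  ⊥-elim (c∉ (here (∷-injectiveˡ (trans (sym (insertAll-lower (c ∷ []) (rowInsert x C) v c<v)) fixed))))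
  where
  c<v : All (λ y → All (_< y) (c ∷ [])) v
  c<v = All.map (λ x<y → <-trans (≮∧≢⇒> x≮c (c∉ ∘ here ∘ sym)) x<y ∷ []) x<v

stable-peel : ∀ r → Unique r → Stable r →
  let u = catMaybes (bumps [] r) in Unique u × Stable u × RowPairOK (insertAll [] r) (insertAll [] u)
stable-peel r unique stable = uniqueU , stableU , proj₂ fixed
  where
  u v C : List ℕ
  u = catMaybes (bumps [] r)
  v = insertAll [] r
  C = insertAll [] u
  disjoint : Unique u × All (_∉ v) u
  disjoint = unique-++⁻ u v (subst Unique (sym stable) unique)
  uniqueU : Unique u
  uniqueU = proj₁ disjoint
  C-fixes-v : insertAll C v ≡ v
  C-fixes-v = trans (sym (insertAll-++ [] u v)) (cong (insertAll []) stable)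
  fixed : catMaybes (bumps C v) ≡ C × RowPairOK v C
  fixed = fixed-insertion C v (insertAll-sorted [] u [] uniqueU []) (insertAll-sorted [] r [] unique [])
    (All.tabulate λ k∈C → [ (λ ()) , All.lookup (proj₂ disjoint) ]′ (∈-insertAll⁻ [] u k∈C)) C-fixes-v
  stableU : Stable u
  stableU = begin
    catMaybes (bumps [] u) ++ C                       ≡⟨ cong (catMaybes (bumps [] u) ++_) (proj₁ fixed) ⟨
    catMaybes (bumps [] u) ++ catMaybes (bumps C v)   ≡⟨ catMaybes-++ (bumps [] u) (bumps C v) ⟨
    catMaybes (bumps [] u ++ bumps C v)               ≡⟨ cong catMaybes (bumps-++ [] u v) ⟨
    catMaybes (bumps [] (u ++ v))                     ≡⟨ cong (catMaybes ∘ bumps []) stable ⟩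
    u                                                 ∎
    where open ≡-Reasoning

stable-shorter : ∀ x r → Stable (x ∷ r) → length (catMaybes (bumps [] (x ∷ r))) ≤ length r
stable-shorter x r stable = ≤-pred (begin
  suc (length u)               ≡⟨ +-comm 1 (length u) ⟩
  length u + 1                 ≤⟨ +-monoʳ-≤ (length u) (insertAll-nonempty (x ∷ []) r (s≤s z≤n)) ⟩
  length u + length v          ≡⟨ length-++ u ⟨
  length (u ++ v)              ≡⟨ cong length stable ⟩
  suc (length r)               ∎)
  where
  open ≤-Reasoning
  u v : List ℕ
  u = catMaybes (bumps [] (x ∷ r))
  v = insertAll [] (x ∷ r)

topRow : List (List ℕ) → List ℕ
topRow [] = []
topRow (R ∷ _) = R

IsTableau : List (List ℕ) → Set
IsTableau T = All NonEmpty T × All StrictlyIncreasing T × ConsecutiveRowsOK T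

consecutiveRows-∷ : ∀ {R T} → RowPairOK R (topRow T) → ConsecutiveRowsOK T → ConsecutiveRowsOK (R ∷ T)
consecutiveRows-∷ {T = []} _ [] = [-]
consecutiveRows-∷ {T = _ ∷ _} rowOK rows = rowOK ∷ rows

stable⇒tableau : ∀ N r → length r ≤ N → Unique r → Stable r →
  Σ (List (List ℕ)) λ T → IsTableau T × rowReadingWord T ≡ r × topRow T ≡ insertAll [] r
stable⇒tableau _ [] _ _ _ = [] , ([] , [] , []) , refl , refl
stable⇒tableau zero (x ∷ r) () _ _
stable⇒tableau (suc N) (x ∷ r) (s≤s len≤N) unique stable
  with stable-peel (x ∷ r) unique stable
... | uniqueU , stableU , rowOK
  with stable⇒tableau N _ (≤-trans (stable-shorter x r stable) len≤N) uniqueU stableU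
... | T , (nonempties , increasings , rows) , reading , top =
  v ∷ T ,
  ( insertAll-nonempty (x ∷ []) r (s≤s z≤n) ∷ nonempties
  , sorted⇒strictlyIncreasing (insertAll-sorted [] (x ∷ r) [] unique []) ∷ increasings
  , consecutiveRows-∷ (subst (RowPairOK v) (sym top) rowOK) rows) ,
  trans (rowReadingWord-∷ v T) (trans (cong (_++ v) reading) stable) ,
  refl
  where
  v : List ℕ
  v = insertAll [] (x ∷ r)

steadyState⇒readingWord : ∀ n r → IsPerm n r → SteadyStateTimeZero n r →
  Σ (List (List ℕ)) (λ T → IsStandardTableau n T × rowReadingWord T ≡ r)
steadyState⇒readingWord n r perm steady
  with stable⇒tableau (length r) r ≤-refl (↭-oneTo⇒unique perm) (steadyState⇒stable n r perm steady)
... | T , (nonempties , increasings , rows) , reading , _ =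
  T , (nonempties , increasings , rows , content) , reading
  where
  content : concat T ↭ oneTo n
  content = ↭-trans (↭-sym (rowReadingWord-↭ T)) (subst (_↭ oneTo n) (sym reading) perm)

proposition5p1 : (n : ℕ) (r : List ℕ) → IsPerm n r →
    SteadyStateTimeZero n r ⇔
      Σ (List (List ℕ)) (λ T → IsStandardTableau n T × rowReadingWord T ≡ r)
proposition5p1 n r perm = mk⇔ (steadyState⇒readingWord n r perm)
  λ (T , tableau , reading) → subst (SteadyStateTimeZero n) reading (readingWord⇒steadyState n T tableau)
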